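{- For all integers $k\ge 1$ and $1\le m\le k$, we have $w_{2k+1,k,m}=w_{2k+1,k,k+1-m}$.
   Context: A Dyck path of semilength $n$ is a word in the letters $U,D$ with $n$ copies of each letter such that no prefix contains more $D$'s than $U$'s. A $UD$-factor (resp. $UUD$-factor) is an occurrence of $UD$ (resp. $UUD$) as a consecutive subword. For nonnegative integers $n,k,m$, $w_{n,k,m}$ denotes the number of Dyck paths of semilength $n$ with exactly $k$ $UD$-factors and exactly $m$ $UUD$-factors. -}

module Defs where

open import Data.Nat using (ℕ; zero; suc; _+_; _*_; _≤_; _≤?_; _≟_)
open import Data.List using (List; []; _∷_; length; filter; map; _++_)
open import Data.Bool using (Bool; true; false; _∧_; T)
open import Relation.Nullary.Decidable using (⌊_⌋)

data Step : Set where
  U D : Step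

words : ℕ → List (List Step)
words zero = [] ∷ []
words (suc l) = map (U ∷_) (words l) ++ map (D ∷_) (words l)

countU : List Step → ℕ
countU [] = 0
countU (U ∷ w) = suc (countU w)
countU (D ∷ w) = countU w

countD : List Step → ℕ
countD [] = 0
countD (U ∷ w) = countD w
countD (D ∷ w) = suc (countD w)

-- No prefix has more D's than U's: scanning with current height h.
prefixOK : ℕ → List Step → Bool
prefixOK h [] = true
prefixOK h (U ∷ w) = prefixOK (suc h) w
prefixOK zero (D ∷ w) = false
prefixOK (suc h) (D ∷ w) = prefixOK h w

isDyck : ℕ → List Step → Bool
isDyck n w = ⌊ countU w ≟ n ⌋ ∧ ⌊ countD w ≟ n ⌋ ∧ prefixOK 0 w

countUD : List Step → ℕ
countUD [] = 0
countUD (U ∷ D ∷ w) = suc (countUD (D ∷ w))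
countUD (_ ∷ w) = countUD w

countUUD : List Step → ℕ
countUUD [] = 0
countUUD (U ∷ U ∷ D ∷ w) = suc (countUUD (U ∷ D ∷ w))
countUUD (_ ∷ w) = countUUD w

-- w n k m : number of Dyck paths of semilength n with exactly k UD-factors
-- and exactly m UUD-factors (every such path is a word of length 2n).
w : ℕ → ℕ → ℕ → ℕ
w n k m = length (filter (λ p → T? (isDyck n p ∧ ⌊ countUD p ≟ k ⌋ ∧ ⌊ countUUD p ≟ m ⌋)) (words (n + n)))
  where
  open import Relation.Nullary using (Dec; yes; no)
  T? : (b : Bool) → Dec (T b)
  T? true = yes _
  T? false = no (λ ())

-- Cut a Dyck path P of semilength 2k + 1 with k peaks into its k blocks U^(1+xᵢ) D^(1+eᵢ); then
-- Σ xᵢ = k + 1, Σ eᵢ = k + 2, and the UUD-factors of P are the nonzero xᵢ. By the cycle lemma (an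
-- integer sequence of sum -1 has exactly one rotation whose proper prefix sums are all nonnegative),
-- rotating the blocks of P D in its k possible ways is a bijection from pairs (P , r < k) onto all
-- block sequences with these sums, so k · w(2k+1, k, m) counts pairs of sequences (x , e) in which x
-- has m nonzero terms. A weak composition x of k + 1 into k parts with m nonzero parts is the same as
-- its support S (a 0/1-word of length k with m ones) together with the stars-and-bars word T of its
-- nonzero parts lowered by one (length k, m - 1 ones); (S , T) ↦ (¬ T , ¬ S) then exchanges m and
-- k + 1 - m and is an involution.

module Submission where

open import Level using (0ℓ)
open import Function.Base using (_∘_)
open import Function.Bundles using (Equivalence; _⇔_; mk⇔)
open import Data.Empty using (⊥)
open import Data.Bool using (Bool; true; false; T; _∧_; not; if_then_else_)
open import Data.Bool.Properties using (T-≡; not-involutive)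
open import Data.Nat using (ℕ; zero; suc; _+_; _*_; _∸_; _≤_; _<_; z≤n; s≤s; s≤s⁻¹; _≟_; >-nonZero)
open import Data.Nat.Properties
  using ( +-identityʳ; +-suc; +-assoc; +-comm; +-cancelʳ-≡; *-cancelʳ-≡; suc-injective; 0≢1+n
        ; n<1+n; <⇒≤; <⇒≱; ≤-trans; ≤-<-trans; <-cmp; m≤m+n; m<m+n; m+n≤o⇒m≤o∸n
        ; +-∸-assoc; m∸n≤m; m∸[m∸n]≡n; m+[n∸m]≡n; m>n⇒m∸n≢0; m<n⇒0<n∸m; module ≤-Reasoning )
import Data.Nat.Tactic.RingSolver as ℕ-Solver
open import Data.Nat.ListAction using (sum)
open import Data.Nat.ListAction.Properties using (sum-↭)
open import Data.Integer using (ℤ; 0ℤ; -1ℤ)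
import Data.Integer as ℤ
import Data.Integer.Properties as ℤ
import Data.Integer.Tactic.RingSolver as ℤ-Solver
open import Data.Product using (_×_; _,_; proj₁; proj₂; ∃-syntax)
import Data.Product as Product
open import Data.Sum using (_⊎_; inj₁; inj₂)
open import Data.List
  using (List; []; _∷_; length; map; filter; foldr; _++_; replicate; take; drop; initLast; _∷ʳ′_; upTo; cartesianProduct)
open import Data.List.Properties
  using ( ≡-dec; ∷-injectiveˡ; ∷-injectiveʳ; ++-assoc; ++-identityʳ; ++-cancelʳ; length-++; length-map
        ; length-replicate; length-upTo; length-drop; map-++; filter-++; take++drop≡id; take-map; drop-map
        ; take-[]; drop-drop )
open import Data.List.Relation.Unary.All using ([])
open import Data.List.Relation.Unary.AllPairs using ([]; _∷_)
open import Data.List.Relation.Unary.Any using (here; there)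
open import Data.List.Membership.Propositional using (_∈_)
open import Data.List.Membership.Propositional.Properties
  using ( ∈-filter⁻; ∈-filter⁺; ∈-map⁺; ∈-map⁻; ∈-++⁺ˡ; ∈-++⁺ʳ; ∈-cartesianProduct⁺; ∈-cartesianProduct⁻
        ; ∈-upTo⁺; ∈-upTo⁻ )
open import Data.List.Membership.Propositional.Properties.WithK using (unique∧set⇒bag)
open import Data.List.Relation.Unary.Unique.Propositional using (Unique)
import Data.List.Relation.Unary.Unique.Propositional.Properties as Unique
open import Data.List.Relation.Binary.BagAndSetEquality using (∼bag⇒↭)
open import Data.List.Relation.Binary.Permutation.Propositional using (_↭_; ↭-trans; ↭-reflexive)
open import Data.List.Relation.Binary.Permutation.Propositional.Properties
  using (↭-length) renaming (++-comm to ↭-++-comm; map⁺ to ↭-map)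
open import Relation.Unary using (Pred; Decidable)
open import Relation.Binary using (DecidableEquality; tri<; tri≈; tri>)
open import Relation.Nullary using (Dec; yes; no; ¬_; contradiction)
open import Relation.Nullary.Decidable using (⌊_⌋; _×-dec_)
open import Relation.Binary.PropositionalEquality
  using (_≡_; refl; sym; trans; cong; cong₂; subst; subst₂; module ≡-Reasoning)

open import Defs

private
  variable
    A B : Set

map-inverseˡ : (f : A → B) (g : B → A) (xs : List A) →
  (∀ {x} → x ∈ xs → g (f x) ≡ x) → map g (map f xs) ≡ xs
map-inverseˡ f g [] inv = refl
map-inverseˡ f g (x ∷ xs) inv = cong₂ _∷_ (inv (here refl)) (map-inverseˡ f g xs (inv ∘ there))

-- Two duplicate-free lists with the same members are permutations of each other.
length-filter-bijection : {P : Pred A 0ℓ} {Q : Pred B 0ℓ} (P? : Decidable P) (Q? : Decidable Q)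
  {xs : List A} {ys : List B} (f : A → B) (g : B → A) → Unique xs → Unique ys →
  (∀ {x} → x ∈ xs → P x → f x ∈ ys × Q (f x) × g (f x) ≡ x) →
  (∀ {y} → y ∈ ys → Q y → g y ∈ xs × P (g y) × f (g y) ≡ y) →
  length (filter P? xs) ≡ length (filter Q? ys)
length-filter-bijection P? Q? {xs} {ys} f g xs! ys! to from = begin
  length (filter P? xs)         ≡⟨ sym (length-map f (filter P? xs)) ⟩
  length (map f (filter P? xs)) ≡⟨ ↭-length (∼bag⇒↭ (unique∧set⇒bag image! (Unique.filter⁺ Q? ys!) same-members)) ⟩
  length (filter Q? ys)         ∎
  where
  open ≡-Reasoning
  left-inverse : ∀ {x} → x ∈ filter P? xs → g (f x) ≡ x
  left-inverse x∈ = let (x∈xs , Px) = ∈-filter⁻ P? x∈ in proj₂ (proj₂ (to x∈xs Px))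
  image! : Unique (map f (filter P? xs))
  image! = Unique.map⁻ (subst Unique (sym (map-inverseˡ f g (filter P? xs) left-inverse)) (Unique.filter⁺ P? xs!))
  into : ∀ {z} → z ∈ map f (filter P? xs) → z ∈ filter Q? ys
  into z∈ with ∈-map⁻ f z∈
  ... | x , x∈ , refl with ∈-filter⁻ P? x∈
  ... | x∈xs , Px with to x∈xs Px
  ... | fx∈ , Qfx , _ = ∈-filter⁺ Q? fx∈ Qfx
  onto : ∀ {z} → z ∈ filter Q? ys → z ∈ map f (filter P? xs)
  onto z∈ with ∈-filter⁻ Q? z∈
  ... | z∈ys , Qz with from z∈ys Qz
  ... | gz∈ , Pgz , fgz = subst (_∈ map f (filter P? xs)) fgz (∈-map⁺ f (∈-filter⁺ P? gz∈ Pgz))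
  same-members : ∀ {z} → z ∈ map f (filter P? xs) ⇔ z ∈ filter Q? ys
  same-members = mk⇔ into onto

filter-cartesianProduct : {P : Pred A 0ℓ} (P? : Decidable P) (xs : List A) (ys : List B) →
  filter (λ z → P? (proj₁ z)) (cartesianProduct xs ys) ≡ cartesianProduct (filter P? xs) ys
filter-cartesianProduct P? [] ys = refl
filter-cartesianProduct P? (x ∷ xs) ys with P? x
... | yes Px = trans (filter-++ (λ z → P? (proj₁ z)) (map (x ,_) ys) (cartesianProduct xs ys))
                     (cong₂ _++_ (filter-all ys) (filter-cartesianProduct P? xs ys))
  where
  filter-all : ∀ zs → filter (λ z → P? (proj₁ z)) (map (x ,_) zs) ≡ map (x ,_) zs
  filter-all [] = refl
  filter-all (z ∷ zs) with P? x
  ... | yes _ = cong ((x , z) ∷_) (filter-all zs)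
  ... | no ¬Px = contradiction Px ¬Px
... | no ¬Px = trans (filter-++ (λ z → P? (proj₁ z)) (map (x ,_) ys) (cartesianProduct xs ys))
                     (cong₂ _++_ (filter-none ys) (filter-cartesianProduct P? xs ys))
  where
  filter-none : ∀ zs → filter (λ z → P? (proj₁ z)) (map (x ,_) zs) ≡ []
  filter-none [] = refl
  filter-none (z ∷ zs) with P? x
  ... | yes Px = contradiction Px ¬Px
  ... | no _ = filter-none zs

length-cartesianProduct : (xs : List A) (ys : List B) → length (cartesianProduct xs ys) ≡ length xs * length ys
length-cartesianProduct [] ys = refl
length-cartesianProduct (x ∷ xs) ys = trans (length-++ (map (x ,_) ys))
  (cong₂ _+_ (length-map (x ,_) ys) (length-cartesianProduct xs ys))
length-filter-×-upTo : {P : Pred A 0ℓ} (P? : Decidable P) (xs : List A) (k : ℕ) →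
  length (filter (λ z → P? (proj₁ z)) (cartesianProduct xs (upTo k))) ≡ length (filter P? xs) * k
length-filter-×-upTo P? xs k = trans (cong length (filter-cartesianProduct P? xs (upTo k)))
  (trans (length-cartesianProduct (filter P? xs) (upTo k)) (cong (length (filter P? xs) *_) (length-upTo k)))


∈-words : ∀ {l} y → length y ≡ l → y ∈ words l
∈-words [] refl = here refl
∈-words (U ∷ y) refl = ∈-++⁺ˡ (∈-map⁺ (U ∷_) (∈-words y refl))
∈-words (D ∷ y) refl = ∈-++⁺ʳ (map (U ∷_) (words (length y))) (∈-map⁺ (D ∷_) (∈-words y refl))

words-unique : ∀ l → Unique (words l)
words-unique zero = [] ∷ []
words-unique (suc l) = Unique.++⁺ (Unique.map⁺ ∷-injectiveʳ (words-unique l))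
  (Unique.map⁺ ∷-injectiveʳ (words-unique l)) U≢D
  where
  U≢D : ∀ {v} → v ∈ map (U ∷_) (words l) × v ∈ map (D ∷_) (words l) → ⊥
  U≢D (v∈U , v∈D) with ∈-map⁻ (U ∷_) v∈U | ∈-map⁻ (D ∷_) v∈D
  ... | _ , _ , refl | _ , _ , ()

isDyckWith : ℕ → ℕ → ℕ → List Step → Bool
isDyckWith n k m P = isDyck n P ∧ ⌊ countUD P ≟ k ⌋ ∧ ⌊ countUUD P ≟ m ⌋

record DyckWith (n k m : ℕ) (P : List Step) : Set where
  constructor dyckWith
  field
    countU≡ : countU P ≡ n
    countD≡ : countD P ≡ n
    ballot : prefixOK 0 P ≡ true
    countUD≡ : countUD P ≡ k
    countUUD≡ : countUUD P ≡ m

T⇒DyckWith : ∀ {n k m} P → T (isDyckWith n k m P) → DyckWith n k m P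
T⇒DyckWith {n} {k} {m} P t
  with countU P ≟ n | countD P ≟ n | prefixOK 0 P in ballot | countUD P ≟ k | countUUD P ≟ m
... | yes ups | yes downs | true | yes ud | yes uud = dyckWith ups downs ballot ud uud

isYes-true : {A : Set} (a? : Dec A) → A → ⌊ a? ⌋ ≡ true
isYes-true (yes _) _ = refl
isYes-true (no ¬a) a = contradiction a ¬a

DyckWith⇒T : ∀ {n k m} P → DyckWith n k m P → T (isDyckWith n k m P)
DyckWith⇒T {n} {k} {m} P (dyckWith ups downs ballot ud uud) = Equivalence.from T-≡
  (cong₂ _∧_ (cong₂ _∧_ (isYes-true (countU P ≟ n) ups) (cong₂ _∧_ (isYes-true (countD P ≟ n) downs) ballot))
             (cong₂ _∧_ (isYes-true (countUD P ≟ k) ud) (isYes-true (countUUD P ≟ m) uud)))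

length≡countU+countD : ∀ w → length w ≡ countU w + countD w
length≡countU+countD [] = refl
length≡countU+countD (U ∷ w) = cong suc (length≡countU+countD w)
length≡countU+countD (D ∷ w) = trans (cong suc (length≡countU+countD w)) (sym (+-suc (countU w) (countD w)))

DyckWith-length : ∀ {n k m P} → DyckWith n k m P → length P ≡ n + n
DyckWith-length {P = P} (dyckWith countU≡ countD≡ _ _ _) = trans (length≡countU+countD P) (cong₂ _+_ countU≡ countD≡)

countU-++ : ∀ Q R → countU (Q ++ R) ≡ countU Q + countU R
countU-++ [] R = refl
countU-++ (U ∷ Q) R = cong suc (countU-++ Q R)
countU-++ (D ∷ Q) R = countU-++ Q R

countD-++ : ∀ Q R → countD (Q ++ R) ≡ countD Q + countD R
countD-++ [] R = refl
countD-++ (U ∷ Q) R = countD-++ Q R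
countD-++ (D ∷ Q) R = cong suc (countD-++ Q R)

countU-++-D : ∀ P → countU (P ++ D ∷ []) ≡ countU P
countU-++-D P = trans (countU-++ P (D ∷ [])) (+-identityʳ (countU P))

countD-++-D : ∀ P → countD (P ++ D ∷ []) ≡ suc (countD P)
countD-++-D P = trans (countD-++ P (D ∷ [])) (+-comm (countD P) 1)

prefixOK-++⁻ˡ : ∀ h Q R → prefixOK h (Q ++ R) ≡ true → prefixOK h Q ≡ true
prefixOK-++⁻ˡ h [] R ok = refl
prefixOK-++⁻ˡ h (U ∷ Q) R ok = prefixOK-++⁻ˡ (suc h) Q R ok
prefixOK-++⁻ˡ (suc h) (D ∷ Q) R ok = prefixOK-++⁻ˡ h Q R ok

prefixOK⇒countD≤ : ∀ h Q → prefixOK h Q ≡ true → countD Q ≤ h + countU Q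
prefixOK⇒countD≤ h [] ok = z≤n
prefixOK⇒countD≤ h (U ∷ Q) ok = subst (countD Q ≤_) (sym (+-suc h (countU Q))) (prefixOK⇒countD≤ (suc h) Q ok)
prefixOK⇒countD≤ (suc h) (D ∷ Q) ok = s≤s (prefixOK⇒countD≤ h Q ok)

Balanced : List Step → Set
Balanced P = countU P ≡ countD P

balanced-ballot-endsD : ∀ P → prefixOK 0 P ≡ true → Balanced P → P ≡ [] ⊎ ∃[ Q ] P ≡ Q ++ D ∷ []
balanced-ballot-endsD P ok bal with initLast P
... | [] = inj₁ refl
... | Q ∷ʳ′ D = inj₂ (Q , refl)
... | Q ∷ʳ′ U = contradiction (prefixOK⇒countD≤ 0 Q (prefixOK-++⁻ˡ 0 Q (U ∷ []) ok)) (<⇒≱ countU<countD)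
  where
  countU<countD : countU Q < countD Q
  countU<countD = begin-strict
    countU Q             <⟨ n<1+n (countU Q) ⟩
    suc (countU Q)       ≡⟨ +-comm 1 (countU Q) ⟩
    countU Q + 1         ≡⟨ sym (countU-++ Q (U ∷ [])) ⟩
    countU (Q ++ U ∷ []) ≡⟨ bal ⟩
    countD (Q ++ U ∷ []) ≡⟨ countD-++ Q (U ∷ []) ⟩
    countD Q + 0         ≡⟨ +-identityʳ (countD Q) ⟩
    countD Q             ∎
    where open ≤-Reasoning

countUD-++-DD : ∀ Q → countUD (Q ++ D ∷ D ∷ []) ≡ countUD (Q ++ D ∷ [])
countUD-++-DD [] = refl
countUD-++-DD (D ∷ Q) = countUD-++-DD Q
countUD-++-DD (U ∷ []) = refl
countUD-++-DD (U ∷ D ∷ Q) = cong suc (countUD-++-DD (D ∷ Q))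
countUD-++-DD (U ∷ U ∷ Q) = countUD-++-DD (U ∷ Q)

countUUD-++-DD : ∀ Q → countUUD (Q ++ D ∷ D ∷ []) ≡ countUUD (Q ++ D ∷ [])
countUUD-++-DD [] = refl
countUUD-++-DD (D ∷ Q) = countUUD-++-DD Q
countUUD-++-DD (U ∷ []) = refl
countUUD-++-DD (U ∷ D ∷ Q) = countUUD-++-DD (D ∷ Q)
countUUD-++-DD (U ∷ U ∷ []) = refl
countUUD-++-DD (U ∷ U ∷ D ∷ Q) = cong suc (countUUD-++-DD (U ∷ D ∷ Q))
countUUD-++-DD (U ∷ U ∷ U ∷ Q) = countUUD-++-DD (U ∷ U ∷ Q)

module _ {P : List Step} (ballot : prefixOK 0 P ≡ true) (balanced : Balanced P) where

  countUD-++-D : countUD (P ++ D ∷ []) ≡ countUD P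
  countUD-++-D with balanced-ballot-endsD P ballot balanced
  ... | inj₁ refl = refl
  ... | inj₂ (Q , refl) = trans (cong countUD (++-assoc Q (D ∷ []) (D ∷ []))) (countUD-++-DD Q)

  countUUD-++-D : countUUD (P ++ D ∷ []) ≡ countUUD P
  countUUD-++-D with balanced-ballot-endsD P ballot balanced
  ... | inj₁ refl = refl
  ... | inj₂ (Q , refl) = trans (cong countUUD (++-assoc Q (D ∷ []) (D ∷ []))) (countUUD-++-DD Q)

-- prefixOK for the proper prefixes only: the last step may end at height -1.
properPrefixOK : ℕ → List Step → Bool
properPrefixOK h [] = true
properPrefixOK h (U ∷ w) = properPrefixOK (suc h) w
properPrefixOK h (D ∷ []) = true
properPrefixOK zero (D ∷ _ ∷ _) = false
properPrefixOK (suc h) (D ∷ s ∷ w) = properPrefixOK h (s ∷ w)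

properPrefixOK-++-D : ∀ h P → properPrefixOK h (P ++ D ∷ []) ≡ prefixOK h P
properPrefixOK-++-D h [] = refl
properPrefixOK-++-D h (U ∷ P) = properPrefixOK-++-D (suc h) P
properPrefixOK-++-D zero (D ∷ []) = refl
properPrefixOK-++-D (suc h) (D ∷ []) = refl
properPrefixOK-++-D zero (D ∷ _ ∷ _) = refl
properPrefixOK-++-D (suc h) (D ∷ s ∷ P) = properPrefixOK-++-D h (s ∷ P)

ballot-startsU : ∀ P → 0 < countU P → prefixOK 0 P ≡ true → ∃[ v ] P ≡ U ∷ v
ballot-startsU (U ∷ v) _ _ = v , refl

replicate-++-∷ : ∀ n (a : A) r → replicate n a ++ a ∷ r ≡ a ∷ replicate n a ++ r
replicate-++-∷ zero a r = refl
replicate-++-∷ (suc n) a r = cong (a ∷_) (replicate-++-∷ n a r)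

Block : Set
Block = ℕ × ℕ

-- The block (x , e) stands for U^(1+x) D^(1+e); a word that starts with U and ends with D is a
-- unique product of blocks.
block : Block → List Step → List Step
block (x , e) r = U ∷ replicate x U ++ D ∷ replicate e D ++ r

toWord : List Block → List Step
toWord [] = []
toWord (b ∷ bs) = block b (toWord bs)

mutual
  blocksAscending : ℕ → List Step → List Block
  blocksAscending x [] = (x , 0) ∷ []
  blocksAscending x (U ∷ w) = blocksAscending (suc x) w
  blocksAscending x (D ∷ w) = blocksDescending x 0 w

  blocksDescending : ℕ → ℕ → List Step → List Block
  blocksDescending x e [] = (x , e) ∷ []
  blocksDescending x e (U ∷ w) = (x , e) ∷ blocksAscending 0 w
  blocksDescending x e (D ∷ w) = blocksDescending x (suc e) w

blocks : List Step → List Block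
blocks [] = []
blocks (U ∷ w) = blocksAscending 0 w
blocks (D ∷ w) = []

blocksAscending-replicate : ∀ x y r → blocksAscending x (replicate y U ++ D ∷ r) ≡ blocksDescending (x + y) 0 r
blocksAscending-replicate x zero r = cong (λ z → blocksDescending z 0 r) (sym (+-identityʳ x))
blocksAscending-replicate x (suc y) r =
  trans (blocksAscending-replicate (suc x) y r) (cong (λ z → blocksDescending z 0 r) (sym (+-suc x y)))

blocksDescending-replicate : ∀ x e y r → blocksDescending x e (replicate y D ++ r) ≡ blocksDescending x (e + y) r
blocksDescending-replicate x e zero r = cong (λ z → blocksDescending x z r) (sym (+-identityʳ e))
blocksDescending-replicate x e (suc y) r =
  trans (blocksDescending-replicate x (suc e) y r) (cong (λ z → blocksDescending x z r) (sym (+-suc e y)))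

blocks-toWord : ∀ bs → blocks (toWord bs) ≡ bs
blocks-toWord [] = refl
blocks-toWord ((x , e) ∷ bs) = begin
  blocksAscending 0 (replicate x U ++ D ∷ replicate e D ++ toWord bs) ≡⟨ blocksAscending-replicate 0 x _ ⟩
  blocksDescending x 0 (replicate e D ++ toWord bs)                   ≡⟨ blocksDescending-replicate x 0 e (toWord bs) ⟩
  blocksDescending x e (toWord bs)                                    ≡⟨ next-block bs ⟩
  (x , e) ∷ blocks (toWord bs)                                        ≡⟨ cong ((x , e) ∷_) (blocks-toWord bs) ⟩
  (x , e) ∷ bs                                                        ∎
  where
  open ≡-Reasoning
  next-block : ∀ bs → blocksDescending x e (toWord bs) ≡ (x , e) ∷ blocks (toWord bs)
  next-block [] = refl
  next-block (_ ∷ _) = refl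

mutual
  toWord-blocksAscending : ∀ x v → toWord (blocksAscending x (v ++ D ∷ [])) ≡ U ∷ replicate x U ++ v ++ D ∷ []
  toWord-blocksAscending x [] = refl
  toWord-blocksAscending x (U ∷ v) =
    trans (toWord-blocksAscending (suc x) v) (cong (U ∷_) (sym (replicate-++-∷ x U (v ++ D ∷ []))))
  toWord-blocksAscending x (D ∷ v) = toWord-blocksDescending x 0 v

  toWord-blocksDescending : ∀ x e v → toWord (blocksDescending x e (v ++ D ∷ [])) ≡ block (x , e) (v ++ D ∷ [])
  toWord-blocksDescending x e [] = cong (λ z → U ∷ replicate x U ++ D ∷ z) (sym (replicate-++-∷ e D []))
  toWord-blocksDescending x e (U ∷ v) = cong (block (x , e)) (toWord-blocksAscending 0 v)
  toWord-blocksDescending x e (D ∷ v) =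
    trans (toWord-blocksDescending x (suc e) v) (cong (λ z → U ∷ replicate x U ++ D ∷ z) (sym (replicate-++-∷ e D (v ++ D ∷ []))))

toWord-blocks : ∀ v → toWord (blocks (U ∷ v ++ D ∷ [])) ≡ U ∷ v ++ D ∷ []
toWord-blocks v = toWord-blocksAscending 0 v

pathOf : List Block → List Step
pathOf [] = []
pathOf ((x , e) ∷ []) = U ∷ replicate x U ++ replicate e D
pathOf (b ∷ b′ ∷ bs) = block b (pathOf (b′ ∷ bs))

pathOf-++-D : ∀ bs → 0 < length bs → pathOf bs ++ D ∷ [] ≡ toWord bs
pathOf-++-D ((x , e) ∷ []) _ = cong (U ∷_) (trans (++-assoc (replicate x U) (replicate e D) (D ∷ []))
  (cong (replicate x U ++_) (replicate-++-∷ e D [])))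
pathOf-++-D ((x , e) ∷ b ∷ bs) _ = trans (cong (U ∷_) (++-assoc (replicate x U) _ (D ∷ [])))
  (cong (λ z → U ∷ replicate x U ++ D ∷ z) (trans (++-assoc (replicate e D) _ (D ∷ []))
    (cong (replicate e D ++_) (pathOf-++-D (b ∷ bs) (s≤s z≤n)))))

ascents descents : List Block → List ℕ
ascents = map proj₁
descents = map proj₂

isPos : ℕ → Bool
isPos zero = false
isPos (suc _) = true

bit : Bool → ℕ
bit false = 0
bit true = 1

ones : List Bool → ℕ
ones bs = sum (map bit bs)

support : List ℕ → List Bool
support = map isPos

positives : List ℕ → ℕ
positives xs = ones (support xs)


countU-replicateU : ∀ x r → countU (replicate x U ++ r) ≡ x + countU r
countU-replicateU zero r = refl
countU-replicateU (suc x) r = cong suc (countU-replicateU x r)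

countU-replicateD : ∀ e r → countU (replicate e D ++ r) ≡ countU r
countU-replicateD zero r = refl
countU-replicateD (suc e) r = countU-replicateD e r

countD-replicateU : ∀ x r → countD (replicate x U ++ r) ≡ countD r
countD-replicateU zero r = refl
countD-replicateU (suc x) r = countD-replicateU x r

countD-replicateD : ∀ e r → countD (replicate e D ++ r) ≡ e + countD r
countD-replicateD zero r = refl
countD-replicateD (suc e) r = cong suc (countD-replicateD e r)

countUD-replicateD : ∀ e r → countUD (replicate e D ++ r) ≡ countUD r
countUD-replicateD zero r = refl
countUD-replicateD (suc e) r = countUD-replicateD e r

countUUD-replicateD : ∀ e r → countUUD (replicate e D ++ r) ≡ countUUD r
countUUD-replicateD zero r = refl
countUUD-replicateD (suc e) r = countUUD-replicateD e r

countUD-block : ∀ x e r → countUD (block (x , e) r) ≡ suc (countUD r)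
countUD-block zero e r = cong suc (countUD-replicateD e r)
countUD-block (suc x) e r = countUD-block x e r

countUUD-block : ∀ x e r → countUUD (block (x , e) r) ≡ bit (isPos x) + countUUD r
countUUD-block zero e r = countUUD-replicateD e r
countUUD-block (suc zero) e r = cong suc (countUUD-replicateD e r)
countUUD-block (suc (suc x)) e r = countUUD-block (suc x) e r

suc-+-assoc : ∀ a b c → suc (a + (b + c)) ≡ a + b + suc c
suc-+-assoc = ℕ-Solver.solve-∀

countU-toWord : ∀ bs → countU (toWord bs) ≡ sum (ascents bs) + length bs
countU-toWord [] = refl
countU-toWord ((x , e) ∷ bs) = begin
  suc (countU (replicate x U ++ D ∷ replicate e D ++ toWord bs)) ≡⟨ cong suc (countU-replicateU x _) ⟩
  suc (x + countU (replicate e D ++ toWord bs))                  ≡⟨ cong (λ c → suc (x + c)) (countU-replicateD e _) ⟩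
  suc (x + countU (toWord bs))                                   ≡⟨ cong (λ c → suc (x + c)) (countU-toWord bs) ⟩
  suc (x + (sum (ascents bs) + length bs))                       ≡⟨ suc-+-assoc x _ _ ⟩
  x + sum (ascents bs) + suc (length bs)                         ∎
  where open ≡-Reasoning

countD-toWord : ∀ bs → countD (toWord bs) ≡ sum (descents bs) + length bs
countD-toWord [] = refl
countD-toWord ((x , e) ∷ bs) = begin
  countD (replicate x U ++ D ∷ replicate e D ++ toWord bs) ≡⟨ countD-replicateU x _ ⟩
  suc (countD (replicate e D ++ toWord bs))                ≡⟨ cong suc (countD-replicateD e _) ⟩
  suc (e + countD (toWord bs))                             ≡⟨ cong (λ c → suc (e + c)) (countD-toWord bs) ⟩
  suc (e + (sum (descents bs) + length bs))                ≡⟨ suc-+-assoc e _ _ ⟩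
  e + sum (descents bs) + suc (length bs)                  ∎
  where open ≡-Reasoning

countUD-toWord : ∀ bs → countUD (toWord bs) ≡ length bs
countUD-toWord [] = refl
countUD-toWord ((x , e) ∷ bs) = trans (countUD-block x e _) (cong suc (countUD-toWord bs))

countUUD-toWord : ∀ bs → countUUD (toWord bs) ≡ positives (ascents bs)
countUUD-toWord [] = refl
countUUD-toWord ((x , e) ∷ bs) = trans (countUUD-block x e _) (cong (bit (isPos x) +_) (countUUD-toWord bs))

pathOf-unique : ∀ bs P → toWord bs ≡ P ++ D ∷ [] → pathOf bs ≡ P
pathOf-unique [] [] ()
pathOf-unique [] (_ ∷ _) ()
pathOf-unique bs@(_ ∷ _) P eq = ++-cancelʳ (D ∷ []) (pathOf bs) P (trans (pathOf-++-D bs (s≤s z≤n)) eq)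

-- Rotations and the cycle lemma

rotate : ℕ → List A → List A
rotate j xs = drop j xs ++ take j xs

rotate-++ : (u t : List A) → rotate (length u) (u ++ t) ≡ t ++ u
rotate-++ u t = cong₂ _++_ (drop-length u) (take-length u)
  where
  drop-length : ∀ u → drop (length u) (u ++ t) ≡ t
  drop-length [] = refl
  drop-length (_ ∷ u) = drop-length u
  take-length : ∀ u → take (length u) (u ++ t) ≡ u
  take-length [] = refl
  take-length (x ∷ u) = cong (x ∷_) (take-length u)

rotate-↭ : ∀ j (xs : List A) → rotate j xs ↭ xs
rotate-↭ j xs = ↭-trans (↭-++-comm (drop j xs) (take j xs)) (↭-reflexive (take++drop≡id j xs))

length-rotate : ∀ j (xs : List A) → length (rotate j xs) ≡ length xs
length-rotate j xs = ↭-length (rotate-↭ j xs)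

rotate-inverse : ∀ j (xs : List A) → rotate (length xs ∸ j) (rotate j xs) ≡ xs
rotate-inverse j xs = begin
  rotate (length xs ∸ j) (rotate j xs)                 ≡⟨ cong (λ i → rotate i (rotate j xs)) (sym (length-drop j xs)) ⟩
  rotate (length (drop j xs)) (drop j xs ++ take j xs) ≡⟨ rotate-++ (drop j xs) (take j xs) ⟩
  take j xs ++ drop j xs                               ≡⟨ take++drop≡id j xs ⟩
  xs                                                   ∎
  where open ≡-Reasoning

take-++-≤ : ∀ n (xs ys : List A) → n ≤ length xs → take n (xs ++ ys) ≡ take n xs
take-++-≤ zero xs ys _ = refl
take-++-≤ (suc n) (x ∷ xs) ys (s≤s n≤) = cong (x ∷_) (take-++-≤ n xs ys n≤)

drop-++-≤ : ∀ n (xs ys : List A) → n ≤ length xs → drop n (xs ++ ys) ≡ drop n xs ++ ys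
drop-++-≤ zero xs ys _ = refl
drop-++-≤ (suc n) (x ∷ xs) ys (s≤s n≤) = drop-++-≤ n xs ys n≤

take-+ : ∀ i j (xs : List A) → take (i + j) xs ≡ take i xs ++ take j (drop i xs)
take-+ zero j xs = refl
take-+ (suc i) j [] = sym (take-[] j)
take-+ (suc i) j (x ∷ xs) = cong (x ∷_) (take-+ i j xs)

rotate-rotate : ∀ i j (xs : List A) → i + j ≤ length xs → rotate j (rotate i xs) ≡ rotate (i + j) xs
rotate-rotate i j xs i+j≤ = begin
  drop j (drop i xs ++ take i xs) ++ take j (drop i xs ++ take i xs)
    ≡⟨ cong₂ _++_ (drop-++-≤ j (drop i xs) (take i xs) j≤) (take-++-≤ j (drop i xs) (take i xs) j≤) ⟩
  (drop j (drop i xs) ++ take i xs) ++ take j (drop i xs)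
    ≡⟨ ++-assoc (drop j (drop i xs)) (take i xs) (take j (drop i xs)) ⟩
  drop j (drop i xs) ++ take i xs ++ take j (drop i xs)
    ≡⟨ cong₂ _++_ (drop-drop i j xs) (sym (take-+ i j xs)) ⟩
  rotate (i + j) xs ∎
  where
  open ≡-Reasoning
  j≤ : j ≤ length (drop i xs)
  j≤ = subst (j ≤_) (sym (length-drop i xs)) (m+n≤o⇒m≤o∸n j (subst (_≤ length xs) (+-comm i j) i+j≤))

sumℤ : List ℤ → ℤ
sumℤ = foldr ℤ._+_ 0ℤ

sumℤ-++ : ∀ u t → sumℤ (u ++ t) ≡ sumℤ u ℤ.+ sumℤ t
sumℤ-++ [] t = sym (ℤ.+-identityˡ (sumℤ t))
sumℤ-++ (a ∷ u) t = trans (cong (ℤ._+_ a) (sumℤ-++ u t)) (sym (ℤ.+-assoc a (sumℤ u) (sumℤ t)))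

sumℤ-rotate : ∀ j v → sumℤ (rotate j v) ≡ sumℤ v
sumℤ-rotate j v = begin
  sumℤ (drop j v ++ take j v)         ≡⟨ sumℤ-++ (drop j v) (take j v) ⟩
  sumℤ (drop j v) ℤ.+ sumℤ (take j v) ≡⟨ ℤ.+-comm (sumℤ (drop j v)) _ ⟩
  sumℤ (take j v) ℤ.+ sumℤ (drop j v) ≡⟨ sym (sumℤ-++ (take j v) (drop j v)) ⟩
  sumℤ (take j v ++ drop j v)         ≡⟨ cong sumℤ (take++drop≡id j v) ⟩
  sumℤ v                              ∎
  where open ≡-Reasoning

Good : List ℤ → Set
Good w = ∀ a u b t → w ≡ (a ∷ u) ++ (b ∷ t) → 0ℤ ℤ.≤ sumℤ (a ∷ u)

++-split : ∀ (t u p q : List A) → t ++ u ≡ p ++ q →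
  (∃[ r ] t ≡ p ++ r × q ≡ r ++ u) ⊎ (∃[ s ] p ≡ t ++ s × u ≡ s ++ q)
++-split [] u p q eq = inj₂ (p , refl , eq)
++-split (x ∷ t) u [] q eq = inj₁ (x ∷ t , refl , sym eq)
++-split (x ∷ t) u (y ∷ p) q eq with refl ← ∷-injectiveˡ eq with ++-split t u p q (∷-injectiveʳ eq)
... | inj₁ (r , t≡ , q≡) = inj₁ (r , cong (x ∷_) t≡ , q≡)
... | inj₂ (s , p≡ , u≡) = inj₂ (s , cong (x ∷_) p≡ , u≡)

-- Both arcs of w cut at d would have nonnegative sums, while sum w = -1.
rotation-not-good : ∀ {w} d → Good w → sumℤ w ≡ -1ℤ → 0 < d → d < length w → ¬ Good (rotate d w)
rotation-not-good {x ∷ w} (suc d) good-w sum-w _ (s≤s d<) good-rotated with drop d w in drop≡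
... | [] = contradiction (trans (sym (length-drop d w)) (cong length drop≡)) (m>n⇒m∸n≢0 d<)
... | b ∷ t = ℤ.<⇒≱ ℤ.-<+ (ℤ.≤-trans nonneg (ℤ.≤-reflexive sum≡))
  where
  w≡ : (x ∷ take d w) ++ (b ∷ t) ≡ x ∷ w
  w≡ = cong (x ∷_) (trans (cong (take d w ++_) (sym drop≡)) (take++drop≡id d w))
  nonneg : 0ℤ ℤ.≤ sumℤ (x ∷ take d w) ℤ.+ sumℤ (b ∷ t)
  nonneg = ℤ.+-mono-≤ (good-w x (take d w) b t (sym w≡)) (good-rotated b t x (take d w) refl)
  sum≡ : sumℤ (x ∷ take d w) ℤ.+ sumℤ (b ∷ t) ≡ -1ℤ
  sum≡ = trans (sym (sumℤ-++ (x ∷ take d w) (b ∷ t))) (trans (cong sumℤ w≡) sum-w)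

later-rotation-not-good : ∀ {v} i j → sumℤ v ≡ -1ℤ → i < j → j < length v →
  Good (rotate i v) → ¬ Good (rotate j v)
later-rotation-not-good {v} i j sum-v i<j j< good-i = subst (¬_ ∘ Good) rotations
  (rotation-not-good (j ∸ i) good-i (trans (sumℤ-rotate i v) sum-v) (m<n⇒0<n∸m i<j) d<)
  where
  i+d≡j : i + (j ∸ i) ≡ j
  i+d≡j = m+[n∸m]≡n (<⇒≤ i<j)
  rotations : rotate (j ∸ i) (rotate i v) ≡ rotate j v
  rotations = trans (rotate-rotate i (j ∸ i) v (subst (_≤ length v) (sym i+d≡j) (<⇒≤ j<)))
                    (cong (λ n → rotate n v) i+d≡j)
  d< : j ∸ i < length (rotate i v)
  d< = subst (j ∸ i <_) (sym (length-rotate i v)) (≤-<-trans (m∸n≤m j i) j<)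

good-rotation-unique : ∀ {v} i j → sumℤ v ≡ -1ℤ → i < length v → j < length v →
  Good (rotate i v) → Good (rotate j v) → i ≡ j
good-rotation-unique i j sum-v i< j< good-i good-j with <-cmp i j
... | tri< i<j _ _ = contradiction good-j (later-rotation-not-good i j sum-v i<j j< good-i)
... | tri≈ _ i≡j _ = i≡j
... | tri> _ _ j<i = contradiction good-i (later-rotation-not-good j i sum-v j<i i< good-j)

-- The shortest prefix of minimal sum.
lowPoint : List ℤ → List ℤ
lowPoint [] = []
lowPoint (d ∷ v) with 0ℤ ℤ.≤? d ℤ.+ sumℤ (lowPoint v)
... | yes _ = []
... | no _ = d ∷ lowPoint v

lowPoint-prefix : ∀ v → ∃[ t ] v ≡ lowPoint v ++ t
lowPoint-prefix [] = [] , refl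
lowPoint-prefix (d ∷ v) with 0ℤ ℤ.≤? d ℤ.+ sumℤ (lowPoint v)
... | yes _ = d ∷ v , refl
... | no _ = let (t , v≡) = lowPoint-prefix v in t , cong (d ∷_) v≡

lowPoint-minimal : ∀ v p q → v ≡ p ++ q → sumℤ (lowPoint v) ℤ.≤ sumℤ p
lowPoint-minimal [] [] q eq = ℤ.≤-refl
lowPoint-minimal (d ∷ v) p q eq with 0ℤ ℤ.≤? d ℤ.+ sumℤ (lowPoint v) | p
... | yes _ | [] = ℤ.≤-refl
... | yes 0≤ | d′ ∷ p′ with refl ← ∷-injectiveˡ eq =
  ℤ.≤-trans 0≤ (ℤ.+-monoʳ-≤ d (lowPoint-minimal v p′ q (∷-injectiveʳ eq)))
... | no ≰0 | [] = ℤ.<⇒≤ (ℤ.≰⇒> ≰0)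
... | no _ | d′ ∷ p′ with refl ← ∷-injectiveˡ eq = ℤ.+-monoʳ-≤ d (lowPoint-minimal v p′ q (∷-injectiveʳ eq))

lowPoint-first : ∀ v p b q → lowPoint v ≡ p ++ b ∷ q → sumℤ (lowPoint v) ℤ.< sumℤ p
lowPoint-first [] [] b q ()
lowPoint-first [] (_ ∷ _) b q ()
lowPoint-first (d ∷ v) p b q eq with 0ℤ ℤ.≤? d ℤ.+ sumℤ (lowPoint v) | p
lowPoint-first (d ∷ v) p b q () | yes _ | []
lowPoint-first (d ∷ v) p b q () | yes _ | _ ∷ _
... | no ≰0 | [] = ℤ.≰⇒> ≰0
... | no _ | d′ ∷ p′ with refl ← ∷-injectiveˡ eq = ℤ.+-monoʳ-< d (lowPoint-first v p′ b q (∷-injectiveʳ eq))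

≤+⇒0≤ : ∀ a b → a ℤ.≤ a ℤ.+ b → 0ℤ ℤ.≤ b
≤+⇒0≤ a b le = subst₂ ℤ._≤_ (ℤ.+-inverseˡ a) cancel (ℤ.+-monoʳ-≤ (ℤ.- a) le)
  where
  cancel : ℤ.- a ℤ.+ (a ℤ.+ b) ≡ b
  cancel = trans (sym (ℤ.+-assoc (ℤ.- a) a b)) (trans (cong (ℤ._+ b) (ℤ.+-inverseˡ a)) (ℤ.+-identityˡ b))

-- A prefix p of t has sum ≥ 0 because sum u ≤ sum (u ++ p); the word t followed by a proper prefix s
-- of u has sum -1 - sum u + sum s ≥ 0 because u is the first prefix of minimal sum.
lowPoint-rotation-good : ∀ u t → sumℤ (u ++ t) ≡ -1ℤ → lowPoint (u ++ t) ≡ u → Good (t ++ u)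
lowPoint-rotation-good u t sum≡ low≡ a u′ b t′ eq with ++-split t u (a ∷ u′) (b ∷ t′) eq
... | inj₁ (r , t≡ , _) = ≤+⇒0≤ (sumℤ u) (sumℤ (a ∷ u′)) (subst₂ ℤ._≤_ (cong sumℤ low≡) (sumℤ-++ u (a ∷ u′))
        (lowPoint-minimal (u ++ t) (u ++ a ∷ u′) r (trans (cong (u ++_) t≡) (sym (++-assoc u (a ∷ u′) r)))))
... | inj₂ (s , p≡ , u≡) =
  subst (0ℤ ℤ.≤_) (sym (trans (cong sumℤ p≡) (sumℤ-++ t s))) (ℤ.i<j⇒suc[i]≤j (begin-strict
  -1ℤ               ≡⟨ sym sum≡ ⟩
  sumℤ (u ++ t)     ≡⟨ sumℤ-++ u t ⟩
  sumℤ u ℤ.+ sumℤ t ≡⟨ ℤ.+-comm (sumℤ u) (sumℤ t) ⟩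
  sumℤ t ℤ.+ sumℤ u <⟨ ℤ.+-monoʳ-< (sumℤ t) u<s ⟩
  sumℤ t ℤ.+ sumℤ s ∎))
  where
  open ℤ.≤-Reasoning
  u<s : sumℤ u ℤ.< sumℤ s
  u<s = subst (ℤ._< sumℤ s) (cong sumℤ low≡) (lowPoint-first (u ++ t) s b t′ (trans low≡ u≡))

good-rotation-exists : ∀ v → sumℤ v ≡ -1ℤ → ∃[ j ] j < length v × Good (rotate j v)
good-rotation-exists [] ()
good-rotation-exists v@(_ ∷ _) sum-v = from-split (lowPoint-prefix v)
  where
  u = lowPoint v
  good : ∀ t → v ≡ u ++ t → Good (t ++ u)
  good t v≡ = lowPoint-rotation-good u t (trans (cong sumℤ (sym v≡)) sum-v) (cong lowPoint (sym v≡))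
  from-split : ∃[ t ] v ≡ u ++ t → ∃[ j ] j < length v × Good (rotate j v)
  from-split ([] , v≡) = 0 , s≤s z≤n , subst Good (sym (trans (++-identityʳ v) (trans v≡ (++-identityʳ u)))) (good [] v≡)
  from-split (b ∷ t , v≡) = length u , u< , subst Good (sym rotation) (good (b ∷ t) v≡)
    where
    rotation : rotate (length u) v ≡ (b ∷ t) ++ u
    rotation = trans (cong (rotate (length u)) v≡) (rotate-++ u (b ∷ t))
    u< : length u < length v
    u< = subst (length u <_) (sym (trans (cong length v≡) (length-++ u))) (m<m+n (length u) (s≤s z≤n))

properPrefixOK-replicateU : ∀ h x w → properPrefixOK h (replicate x U ++ w) ≡ properPrefixOK (h + x) w
properPrefixOK-replicateU h zero w = cong (λ h′ → properPrefixOK h′ w) (sym (+-identityʳ h))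
properPrefixOK-replicateU h (suc x) w =
  trans (properPrefixOK-replicateU (suc h) x w) (cong (λ h′ → properPrefixOK h′ w) (sym (+-suc h x)))

properPrefixOK-block : ∀ h x e r →
  properPrefixOK h (block (x , e) r) ≡ properPrefixOK (suc (h + x)) (D ∷ replicate e D ++ r)
properPrefixOK-block h x e r = properPrefixOK-replicateU (suc h) x _

properPrefixOK-lastDescent : ∀ H e → e ≤ H → properPrefixOK H (D ∷ replicate e D ++ []) ≡ true
properPrefixOK-lastDescent H zero _ = refl
properPrefixOK-lastDescent (suc H) (suc e) (s≤s e≤) = properPrefixOK-lastDescent H e e≤

properPrefixOK-descent : ∀ H e r → properPrefixOK H (D ∷ replicate e D ++ U ∷ r) ≡ true ⇔
  (e < H × properPrefixOK (H ∸ suc e) (U ∷ r) ≡ true)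
properPrefixOK-descent zero zero r = mk⇔ (λ ()) (λ ())
properPrefixOK-descent zero (suc e) r = mk⇔ (λ ()) (λ ())
properPrefixOK-descent (suc H) zero r = mk⇔ (s≤s z≤n ,_) proj₂
properPrefixOK-descent (suc H) (suc e) r = mk⇔
  (Product.map₁ s≤s ∘ Equivalence.to (properPrefixOK-descent H e r))
  (Equivalence.from (properPrefixOK-descent H e r) ∘ Product.map₁ s≤s⁻¹)

-- A product of blocks is lowest at the ends of its blocks, so whether it stays nonnegative only
-- depends on the partial sums of the height changes x - e of its blocks.
diff : Block → ℤ
diff (x , e) = x ℤ.⊖ e

diffs : List Block → List ℤ
diffs = map diff

GoodFrom : ℤ → List ℤ → Set
GoodFrom c w = ∀ a u b t → w ≡ (a ∷ u) ++ (b ∷ t) → 0ℤ ℤ.≤ c ℤ.+ sumℤ (a ∷ u)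

GoodFrom-∷⁺ : ∀ {c d d′ v} → 0ℤ ℤ.≤ c ℤ.+ d → GoodFrom (c ℤ.+ d) (d′ ∷ v) → GoodFrom c (d ∷ d′ ∷ v)
GoodFrom-∷⁺ {c} {d} 0≤ good a [] b t refl = subst (λ z → 0ℤ ℤ.≤ c ℤ.+ z) (sym (ℤ.+-identityʳ d)) 0≤
GoodFrom-∷⁺ {c} {d} 0≤ good a (a′ ∷ u) b t refl = subst (0ℤ ℤ.≤_) (ℤ.+-assoc c d _) (good a′ u b t refl)

GoodFrom-∷⁻ : ∀ {c d d′ v} → GoodFrom c (d ∷ d′ ∷ v) → 0ℤ ℤ.≤ c ℤ.+ d × GoodFrom (c ℤ.+ d) (d′ ∷ v)
GoodFrom-∷⁻ {c} {d} {d′} {v} good =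
  subst (λ z → 0ℤ ℤ.≤ c ℤ.+ z) (ℤ.+-identityʳ d) (good d [] d′ v refl) ,
  λ a u b t eq → subst (0ℤ ℤ.≤_) (sym (ℤ.+-assoc c d _)) (good d (a ∷ u) b t (cong (d ∷_) eq))

GoodFrom-0ℤ : ∀ {w} → GoodFrom 0ℤ w ⇔ Good w
GoodFrom-0ℤ = mk⇔ (λ good a u b t eq → subst (0ℤ ℤ.≤_) (ℤ.+-identityˡ _) (good a u b t eq))
                  (λ good a u b t eq → subst (0ℤ ℤ.≤_) (sym (ℤ.+-identityˡ _)) (good a u b t eq))

⊖-+-⊖ : ∀ a b c d → a ℤ.⊖ b ℤ.+ (c ℤ.⊖ d) ≡ (a + c) ℤ.⊖ (b + d)
⊖-+-⊖ a b c d = begin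
  a ℤ.⊖ b ℤ.+ (c ℤ.⊖ d)                 ≡⟨ sym (cong₂ ℤ._+_ (ℤ.[+m]-[+n]≡m⊖n a b) (ℤ.[+m]-[+n]≡m⊖n c d)) ⟩
  ℤ.+ a ℤ.- ℤ.+ b ℤ.+ (ℤ.+ c ℤ.- ℤ.+ d) ≡⟨ interchange (ℤ.+ a) (ℤ.+ b) (ℤ.+ c) (ℤ.+ d) ⟩
  ℤ.+ a ℤ.+ ℤ.+ c ℤ.- (ℤ.+ b ℤ.+ ℤ.+ d) ≡⟨ ℤ.[+m]-[+n]≡m⊖n (a + c) (b + d) ⟩
  (a + c) ℤ.⊖ (b + d)                   ∎
  where
  open ≡-Reasoning
  interchange : ∀ w x y z → w ℤ.- x ℤ.+ (y ℤ.- z) ≡ w ℤ.+ y ℤ.- (x ℤ.+ z)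
  interchange = ℤ-Solver.solve-∀

n⊖1+n : ∀ n → n ℤ.⊖ suc n ≡ -1ℤ
n⊖1+n zero = refl
n⊖1+n (suc n) = trans (ℤ.[1+m]⊖[1+n]≡m⊖n n (suc n)) (n⊖1+n n)

0≤⊖⇒≤ : ∀ n e → 0ℤ ℤ.≤ n ℤ.⊖ e → e ≤ n
0≤⊖⇒≤ n zero _ = z≤n
0≤⊖⇒≤ zero (suc e) ()
0≤⊖⇒≤ (suc n) (suc e) 0≤ = s≤s (0≤⊖⇒≤ n e (subst (0ℤ ℤ.≤_) (ℤ.[1+m]⊖[1+n]≡m⊖n n e) 0≤))

⊖≡-1⇒≤ : ∀ n e → n ℤ.⊖ e ≡ -1ℤ → e ≤ suc n
⊖≡-1⇒≤ n zero _ = z≤n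
⊖≡-1⇒≤ zero (suc zero) _ = s≤s z≤n
⊖≡-1⇒≤ (suc n) (suc e) eq = s≤s (⊖≡-1⇒≤ n e (trans (sym (ℤ.[1+m]⊖[1+n]≡m⊖n n e)) eq))

height-block : ∀ h x e → e ≤ h + x → ℤ.+ h ℤ.+ (x ℤ.⊖ e) ≡ ℤ.+ (h + x ∸ e)
height-block h x e e≤ = trans (ℤ.distribʳ-⊖-+-pos h x e) (ℤ.⊖-≥ e≤)

properPrefixOK⇒GoodFrom : ∀ h bs → properPrefixOK h (toWord bs) ≡ true → GoodFrom (ℤ.+ h) (diffs bs)
properPrefixOK⇒GoodFrom h [] _ _ _ _ _ ()
properPrefixOK⇒GoodFrom h (_ ∷ []) _ _ [] _ _ ()
properPrefixOK⇒GoodFrom h (_ ∷ []) _ _ (_ ∷ _) _ _ ()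
properPrefixOK⇒GoodFrom h ((x , e) ∷ b ∷ bs) ok =
  GoodFrom-∷⁺ {ℤ.+ h} (subst (0ℤ ℤ.≤_) (sym height≡) (ℤ.+≤+ z≤n))
    (subst (λ c → GoodFrom c (diffs (b ∷ bs))) (sym height≡)
      (properPrefixOK⇒GoodFrom (h + x ∸ e) (b ∷ bs) (proj₂ descent)))
  where
  descent = Equivalence.to (properPrefixOK-descent (suc (h + x)) e _) (trans (sym (properPrefixOK-block h x e _)) ok)
  height≡ = height-block h x e (s≤s⁻¹ (proj₁ descent))

GoodFrom⇒properPrefixOK : ∀ h bs → ℤ.+ h ℤ.+ sumℤ (diffs bs) ≡ -1ℤ → GoodFrom (ℤ.+ h) (diffs bs) →
  properPrefixOK h (toWord bs) ≡ true
GoodFrom⇒properPrefixOK h [] _ _ = refl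
GoodFrom⇒properPrefixOK h ((x , e) ∷ []) sum≡ _ = trans (properPrefixOK-block h x e [])
  (properPrefixOK-lastDescent (suc (h + x)) e (⊖≡-1⇒≤ (h + x) e (begin
    (h + x) ℤ.⊖ e              ≡⟨ sym (ℤ.distribʳ-⊖-+-pos h x e) ⟩
    ℤ.+ h ℤ.+ (x ℤ.⊖ e)        ≡⟨ cong (ℤ._+_ (ℤ.+ h)) (sym (ℤ.+-identityʳ (x ℤ.⊖ e))) ⟩
    ℤ.+ h ℤ.+ (x ℤ.⊖ e ℤ.+ 0ℤ) ≡⟨ sum≡ ⟩
    -1ℤ                        ∎)))
  where open ≡-Reasoning
GoodFrom⇒properPrefixOK h ((x , e) ∷ b ∷ bs) sum≡ good =
  trans (properPrefixOK-block h x e _) (Equivalence.from (properPrefixOK-descent (suc (h + x)) e _)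
    (s≤s e≤ , GoodFrom⇒properPrefixOK (h + x ∸ e) (b ∷ bs) sum′≡
                (subst (λ c → GoodFrom c (diffs (b ∷ bs))) height≡ (proj₂ first))))
  where
  first = GoodFrom-∷⁻ {ℤ.+ h} good
  e≤ = 0≤⊖⇒≤ (h + x) e (subst (0ℤ ℤ.≤_) (ℤ.distribʳ-⊖-+-pos h x e) (proj₁ first))
  height≡ = height-block h x e e≤
  sum′≡ : ℤ.+ (h + x ∸ e) ℤ.+ sumℤ (diffs (b ∷ bs)) ≡ -1ℤ
  sum′≡ = trans (cong (ℤ._+ sumℤ (diffs (b ∷ bs))) (sym height≡)) (trans (ℤ.+-assoc (ℤ.+ h) (x ℤ.⊖ e) _) sum≡)

properPrefixOK⇔Good : ∀ bs → sumℤ (diffs bs) ≡ -1ℤ → properPrefixOK 0 (toWord bs) ≡ true ⇔ Good (diffs bs)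
properPrefixOK⇔Good bs sum≡ = mk⇔
  (Equivalence.to GoodFrom-0ℤ ∘ properPrefixOK⇒GoodFrom 0 bs)
  (GoodFrom⇒properPrefixOK 0 bs (trans (ℤ.+-identityˡ _) sum≡) ∘ Equivalence.from GoodFrom-0ℤ)

diffs-rotate : ∀ j bs → diffs (rotate j bs) ≡ rotate j (diffs bs)
diffs-rotate j bs = trans (map-++ diff (drop j bs) (take j bs)) (sym (cong₂ _++_ (drop-map j bs) (take-map j bs)))

-- Weak compositions

inflate : List Bool → List ℕ → List ℕ
inflate [] _ = []
inflate (false ∷ S) cs = 0 ∷ inflate S cs
inflate (true ∷ S) [] = 0 ∷ inflate S []
inflate (true ∷ S) (c ∷ cs) = suc c ∷ inflate S cs

shrink : List ℕ → List ℕ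
shrink [] = []
shrink (zero ∷ xs) = shrink xs
shrink (suc x ∷ xs) = x ∷ shrink xs


support-inflate : ∀ S cs → ones S ≡ length cs → support (inflate S cs) ≡ S
support-inflate [] cs _ = refl
support-inflate (false ∷ S) cs fits = cong (false ∷_) (support-inflate S cs fits)
support-inflate (true ∷ S) (c ∷ cs) fits = cong (true ∷_) (support-inflate S cs (suc-injective fits))

shrink-inflate : ∀ S cs → ones S ≡ length cs → shrink (inflate S cs) ≡ cs
shrink-inflate [] [] _ = refl
shrink-inflate (false ∷ S) cs fits = shrink-inflate S cs fits
shrink-inflate (true ∷ S) (c ∷ cs) fits = cong (c ∷_) (shrink-inflate S cs (suc-injective fits))

length-inflate : ∀ S cs → length (inflate S cs) ≡ length S
length-inflate [] cs = refl
length-inflate (false ∷ S) cs = cong suc (length-inflate S cs)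
length-inflate (true ∷ S) [] = cong suc (length-inflate S [])
length-inflate (true ∷ S) (c ∷ cs) = cong suc (length-inflate S cs)

sum-inflate : ∀ S cs → ones S ≡ length cs → sum (inflate S cs) ≡ sum cs + length cs
sum-inflate [] [] _ = refl
sum-inflate (false ∷ S) cs fits = sum-inflate S cs fits
sum-inflate (true ∷ S) (c ∷ cs) fits = begin
  suc c + sum (inflate S cs)   ≡⟨ cong (suc c +_) (sum-inflate S cs (suc-injective fits)) ⟩
  suc c + (sum cs + length cs) ≡⟨ suc-+-assoc c (sum cs) (length cs) ⟩
  c + sum cs + suc (length cs) ∎
  where open ≡-Reasoning

inflate-support-shrink : ∀ xs → inflate (support xs) (shrink xs) ≡ xs
inflate-support-shrink [] = refl
inflate-support-shrink (zero ∷ xs) = cong (0 ∷_) (inflate-support-shrink xs)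
inflate-support-shrink (suc x ∷ xs) = cong (suc x ∷_) (inflate-support-shrink xs)

length-shrink : ∀ xs → length (shrink xs) ≡ positives xs
length-shrink [] = refl
length-shrink (zero ∷ xs) = length-shrink xs
length-shrink (suc x ∷ xs) = cong suc (length-shrink xs)

sum-shrink : ∀ xs → sum (shrink xs) + positives xs ≡ sum xs
sum-shrink [] = refl
sum-shrink (zero ∷ xs) = sum-shrink xs
sum-shrink (suc x ∷ xs) = begin
  x + sum (shrink xs) + suc (positives xs)   ≡⟨ +-suc (x + sum (shrink xs)) (positives xs) ⟩
  suc (x + sum (shrink xs) + positives xs)   ≡⟨ cong suc (+-assoc x (sum (shrink xs)) (positives xs)) ⟩
  suc (x + (sum (shrink xs) + positives xs)) ≡⟨ cong (λ s → suc (x + s)) (sum-shrink xs) ⟩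
  suc (x + sum xs)                           ∎
  where open ≡-Reasoning

-- Stars and bars, with an extra leading bar.
bars : List ℕ → List Bool
bars [] = []
bars (c ∷ cs) = true ∷ replicate c false ++ bars cs

parts : ℕ → List Bool → List ℕ
parts n [] = n ∷ []
parts n (false ∷ T) = parts (suc n) T
parts n (true ∷ T) = n ∷ parts 0 T

length-bars : ∀ cs → length (bars cs) ≡ sum cs + length cs
length-bars [] = refl
length-bars (c ∷ cs) = begin
  suc (length (replicate c false ++ bars cs))         ≡⟨ cong suc (length-++ (replicate c false)) ⟩
  suc (length (replicate c false) + length (bars cs)) ≡⟨ cong₂ (λ a b → suc (a + b)) (length-replicate c) (length-bars cs) ⟩
  suc (c + (sum cs + length cs))                      ≡⟨ suc-+-assoc c (sum cs) (length cs) ⟩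
  c + sum cs + suc (length cs)                        ∎
  where open ≡-Reasoning

ones-replicate-false : ∀ c T → ones (replicate c false ++ T) ≡ ones T
ones-replicate-false zero T = refl
ones-replicate-false (suc c) T = ones-replicate-false c T

ones-bars : ∀ cs → ones (bars cs) ≡ length cs
ones-bars [] = refl
ones-bars (c ∷ cs) = cong suc (trans (ones-replicate-false c (bars cs)) (ones-bars cs))

bars-parts : ∀ n T → bars (parts n T) ≡ true ∷ replicate n false ++ T
bars-parts n [] = refl
bars-parts n (false ∷ T) = trans (bars-parts (suc n) T) (cong (true ∷_) (sym (replicate-++-∷ n false T)))
bars-parts n (true ∷ T) = cong (λ z → true ∷ replicate n false ++ z) (bars-parts 0 T)

parts-replicate : ∀ n c T → parts n (replicate c false ++ T) ≡ parts (n + c) T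
parts-replicate n zero T = cong (λ m → parts m T) (sym (+-identityʳ n))
parts-replicate n (suc c) T = trans (parts-replicate (suc n) c T) (cong (λ m → parts m T) (sym (+-suc n c)))

parts-bars : ∀ n cs → parts n (bars cs) ≡ n ∷ cs
parts-bars n [] = refl
parts-bars n (c ∷ cs) = cong (n ∷_) (trans (parts-replicate 0 c (bars cs)) (parts-bars c cs))

ones-not : ∀ B → ones (map not B) + ones B ≡ length B
ones-not [] = refl
ones-not (false ∷ B) = cong suc (ones-not B)
ones-not (true ∷ B) = trans (+-suc (ones (map not B)) (ones B)) (cong suc (ones-not B))

map-not-involutive : ∀ B → map not (map not B) ≡ B
map-not-involutive [] = refl
map-not-involutive (b ∷ B) = cong₂ _∷_ (not-involutive b) (map-not-involutive B)

IsComposition : ℕ → List ℕ → Set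
IsComposition k xs = length xs ≡ k × sum xs ≡ suc k

Code : Set
Code = List Bool × List Bool

IsCode : ℕ → Code → Set
IsCode k (S , T) = length S ≡ k × length T ≡ k × ones S ≡ suc (ones T)

encode : List ℕ → Code
encode xs = support xs , drop 1 (bars (shrink xs))

decode : Code → List ℕ
decode (S , T) = inflate S (parts 0 T)

dual : Code → Code
dual (S , T) = map not T , map not S

dualComposition : List ℕ → List ℕ
dualComposition xs = decode (dual (encode xs))

encode-correct : ∀ {k} xs → IsComposition k xs → IsCode k (encode xs) × decode (encode xs) ≡ xs
encode-correct {k} xs (length≡ , sum≡)
  with shrink xs | inflate-support-shrink xs | length-shrink xs | sum-shrink xs
... | [] | _ | length≡0 | sum≡0 = contradiction (trans (trans (cong (0 +_) length≡0) sum≡0) sum≡) 0≢1+n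
... | c ∷ cs | inflate≡ | length≡p | sum≡p =
  (trans (length-map isPos xs) length≡ , suc-injective length-T , trans (sym length≡p) (sym (ones-bars (c ∷ cs)))) ,
  trans (cong (inflate (support xs)) (trans (parts-replicate 0 c (bars cs)) (parts-bars c cs))) inflate≡
  where
  length-T : suc (length (replicate c false ++ bars cs)) ≡ suc k
  length-T = trans (length-bars (c ∷ cs)) (trans (cong (sum (c ∷ cs) +_) length≡p) (trans sum≡p sum≡))

decode-correct : ∀ {k} c → IsCode k c → IsComposition k (decode c) × encode (decode c) ≡ c
decode-correct {k} (S , T) (length-S , length-T , ones≡) =
  (trans (length-inflate S cs) length-S , sum≡) ,
  cong₂ _,_ (support-inflate S cs fits) (trans (cong (drop 1 ∘ bars) (shrink-inflate S cs fits)) (cong (drop 1) bars≡))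
  where
  cs = parts 0 T
  bars≡ : bars cs ≡ true ∷ T
  bars≡ = bars-parts 0 T
  fits : ones S ≡ length cs
  fits = trans ones≡ (trans (cong ones (sym bars≡)) (ones-bars cs))
  sum≡ : sum (inflate S cs) ≡ suc k
  sum≡ = trans (sum-inflate S cs fits) (trans (sym (length-bars cs)) (trans (cong length bars≡) (cong suc length-T)))

dual-IsCode : ∀ {k} c → IsCode k c → IsCode k (dual c)
dual-IsCode {k} (S , T) (length-S , length-T , ones≡) =
  trans (length-map not T) length-T , trans (length-map not S) length-S ,
  +-cancelʳ-≡ (ones T) (ones (map not T)) (suc (ones (map not S))) (begin
    ones (map not T) + ones T       ≡⟨ trans (ones-not T) (trans length-T (sym length-S)) ⟩
    length S                        ≡⟨ sym (ones-not S) ⟩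
    ones (map not S) + ones S       ≡⟨ cong (ones (map not S) +_) ones≡ ⟩
    ones (map not S) + suc (ones T) ≡⟨ +-suc (ones (map not S)) (ones T) ⟩
    suc (ones (map not S)) + ones T ∎)
  where open ≡-Reasoning

dual-involutive : ∀ c → dual (dual c) ≡ c
dual-involutive (S , T) = cong₂ _,_ (map-not-involutive S) (map-not-involutive T)

module _ {k : ℕ} (xs : List ℕ) (composition : IsComposition k xs) where

  private
    code-xs = proj₁ (encode-correct xs composition)
    dual-code = dual-IsCode (encode xs) code-xs

  dualComposition-IsComposition : IsComposition k (dualComposition xs)
  dualComposition-IsComposition = proj₁ (decode-correct (dual (encode xs)) dual-code)

  dualComposition-involutive : dualComposition (dualComposition xs) ≡ xs
  dualComposition-involutive = begin
    decode (dual (encode (decode (dual (encode xs))))) ≡⟨ cong (decode ∘ dual) (proj₂ (decode-correct (dual (encode xs)) dual-code)) ⟩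
    decode (dual (dual (encode xs)))                   ≡⟨ cong decode (dual-involutive (encode xs)) ⟩
    decode (encode xs)                                 ≡⟨ proj₂ (encode-correct xs composition) ⟩
    xs                                                 ∎
    where open ≡-Reasoning

  positives-dualComposition : positives (dualComposition xs) + positives xs ≡ suc k
  positives-dualComposition = begin
    ones (support (dualComposition xs)) + ones (support xs) ≡⟨ cong (λ S → ones S + ones (support xs)) support≡ ⟩
    ones (map not bs) + ones (support xs)                   ≡⟨ cong (ones (map not bs) +_) (proj₂ (proj₂ code-xs)) ⟩
    ones (map not bs) + suc (ones bs)                       ≡⟨ +-suc (ones (map not bs)) (ones bs) ⟩
    suc (ones (map not bs) + ones bs)                       ≡⟨ cong suc (trans (ones-not bs) (proj₁ (proj₂ code-xs))) ⟩
    suc k                                                   ∎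
    where
    open ≡-Reasoning
    bs = proj₂ (encode xs)
    support≡ : support (dualComposition xs) ≡ map not bs
    support≡ = cong proj₁ (proj₂ (decode-correct (dual (encode xs)) dual-code))

_≟ₛ_ : DecidableEquality Step
U ≟ₛ U = yes refl
U ≟ₛ D = no λ ()
D ≟ₛ U = no λ ()
D ≟ₛ D = yes refl

BlockStats : ℕ → ℕ → List Block → Set
BlockStats k m bs =
  length bs ≡ k × sum (ascents bs) ≡ suc k × sum (descents bs) ≡ suc (suc k) × positives (ascents bs) ≡ m

BlockWord : ℕ → ℕ → List Step → Set
BlockWord k m y = toWord (blocks y) ≡ y × BlockStats k m (blocks y)

blockWord? : ∀ k m → Decidable (BlockWord k m)
blockWord? k m y = ≡-dec _≟ₛ_ (toWord bs) y ×-dec length bs ≟ k ×-dec sum (ascents bs) ≟ suc k ×-dec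
  sum (descents bs) ≟ suc (suc k) ×-dec positives (ascents bs) ≟ m
  where bs = blocks y

BlockStats-rotate : ∀ {k m} j bs → BlockStats k m bs → BlockStats k m (rotate j bs)
BlockStats-rotate j bs (length≡ , ascents≡ , descents≡ , positives≡) =
  trans (↭-length σ) length≡ , trans (sum-↭ (↭-map proj₁ σ)) ascents≡ , trans (sum-↭ (↭-map proj₂ σ)) descents≡ ,
  trans (sum-↭ (↭-map bit (↭-map isPos (↭-map proj₁ σ)))) positives≡
  where σ = rotate-↭ j bs

sumℤ-diffs : ∀ bs → sumℤ (diffs bs) ≡ sum (ascents bs) ℤ.⊖ sum (descents bs)
sumℤ-diffs [] = refl
sumℤ-diffs ((x , e) ∷ bs) = begin
  x ℤ.⊖ e ℤ.+ sumℤ (diffs bs)                          ≡⟨ cong (ℤ._+_ (x ℤ.⊖ e)) (sumℤ-diffs bs) ⟩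
  x ℤ.⊖ e ℤ.+ (sum (ascents bs) ℤ.⊖ sum (descents bs)) ≡⟨ ⊖-+-⊖ x e (sum (ascents bs)) (sum (descents bs)) ⟩
  (x + sum (ascents bs)) ℤ.⊖ (e + sum (descents bs))   ∎
  where open ≡-Reasoning

BlockStats⇒sumℤ-diffs : ∀ {k m} bs → BlockStats k m bs → sumℤ (diffs bs) ≡ -1ℤ
BlockStats⇒sumℤ-diffs {k} bs (_ , ascents≡ , descents≡ , _) =
  trans (sumℤ-diffs bs) (trans (cong₂ ℤ._⊖_ ascents≡ descents≡) (n⊖1+n (suc k)))

semilength : ∀ k → suc k + k ≡ 2 * k + 1
semilength = ℕ-Solver.solve-∀

module _ {k m : ℕ} {P : List Step} (dyck : DyckWith (2 * k + 1) k m P) where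

  open DyckWith dyck

  private
    bs = blocks (P ++ D ∷ [])
    balanced : Balanced P
    balanced = trans countU≡ (sym countD≡)

  toWord-blocks-dyck : toWord bs ≡ P ++ D ∷ []
  toWord-blocks-dyck with ballot-startsU P (subst (0 <_) (sym (trans countU≡ (+-comm (2 * k) 1))) (s≤s z≤n)) ballot
  ... | v , refl = toWord-blocks v

  BlockStats-dyck : BlockStats k m bs
  BlockStats-dyck = length≡ , ascents≡ , descents≡ , positives≡
    where
    open ≡-Reasoning
    length≡ : length bs ≡ k
    length≡ = begin
      length bs             ≡⟨ sym (countUD-toWord bs) ⟩
      countUD (toWord bs)   ≡⟨ cong countUD toWord-blocks-dyck ⟩
      countUD (P ++ D ∷ []) ≡⟨ countUD-++-D {P} ballot balanced ⟩
      countUD P             ≡⟨ countUD≡ ⟩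
      k                     ∎
    ascents≡ : sum (ascents bs) ≡ suc k
    ascents≡ = +-cancelʳ-≡ k (sum (ascents bs)) (suc k) (begin
      sum (ascents bs) + k         ≡⟨ cong (sum (ascents bs) +_) (sym length≡) ⟩
      sum (ascents bs) + length bs ≡⟨ sym (countU-toWord bs) ⟩
      countU (toWord bs)           ≡⟨ cong countU toWord-blocks-dyck ⟩
      countU (P ++ D ∷ [])         ≡⟨ countU-++-D P ⟩
      countU P                     ≡⟨ countU≡ ⟩
      2 * k + 1                    ≡⟨ sym (semilength k) ⟩
      suc k + k                    ∎)
    descents≡ : sum (descents bs) ≡ suc (suc k)
    descents≡ = +-cancelʳ-≡ k (sum (descents bs)) (suc (suc k)) (begin
      sum (descents bs) + k         ≡⟨ cong (sum (descents bs) +_) (sym length≡) ⟩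
      sum (descents bs) + length bs ≡⟨ sym (countD-toWord bs) ⟩
      countD (toWord bs)            ≡⟨ cong countD toWord-blocks-dyck ⟩
      countD (P ++ D ∷ [])          ≡⟨ countD-++-D P ⟩
      suc (countD P)                ≡⟨ cong suc countD≡ ⟩
      suc (2 * k + 1)               ≡⟨ cong suc (sym (semilength k)) ⟩
      suc (suc k) + k               ∎)
    positives≡ : positives (ascents bs) ≡ m
    positives≡ = begin
      positives (ascents bs) ≡⟨ sym (countUUD-toWord bs) ⟩
      countUUD (toWord bs)   ≡⟨ cong countUUD toWord-blocks-dyck ⟩
      countUUD (P ++ D ∷ []) ≡⟨ countUUD-++-D {P} ballot balanced ⟩
      countUUD P             ≡⟨ countUUD≡ ⟩
      m                      ∎

  properPrefixOK-dyck : properPrefixOK 0 (toWord bs) ≡ true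
  properPrefixOK-dyck = trans (cong (properPrefixOK 0) toWord-blocks-dyck) (trans (properPrefixOK-++-D 0 P) ballot)

module _ {k m : ℕ} (bs : List Block) (nonempty : 0 < length bs) (stats : BlockStats k m bs)
         (ok : properPrefixOK 0 (toWord bs) ≡ true) where

  private
    P = pathOf bs
    P++D≡ : P ++ D ∷ [] ≡ toWord bs
    P++D≡ = pathOf-++-D bs nonempty
    length≡ = proj₁ stats
    ascents≡ = proj₁ (proj₂ stats)
    descents≡ = proj₁ (proj₂ (proj₂ stats))
    positives≡ = proj₂ (proj₂ (proj₂ stats))
    open ≡-Reasoning

  DyckWith-pathOf : DyckWith (2 * k + 1) k m P
  DyckWith-pathOf = dyckWith countU≡ countD≡ ballot countUD≡ countUUD≡
    where
    countU≡ : countU P ≡ 2 * k + 1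
    countU≡ = begin
      countU P                     ≡⟨ sym (countU-++-D P) ⟩
      countU (P ++ D ∷ [])         ≡⟨ cong countU P++D≡ ⟩
      countU (toWord bs)           ≡⟨ countU-toWord bs ⟩
      sum (ascents bs) + length bs ≡⟨ cong₂ _+_ ascents≡ length≡ ⟩
      suc k + k                    ≡⟨ semilength k ⟩
      2 * k + 1                    ∎
    countD≡ : countD P ≡ 2 * k + 1
    countD≡ = suc-injective (begin
      suc (countD P)                ≡⟨ sym (countD-++-D P) ⟩
      countD (P ++ D ∷ [])          ≡⟨ cong countD P++D≡ ⟩
      countD (toWord bs)            ≡⟨ countD-toWord bs ⟩
      sum (descents bs) + length bs ≡⟨ cong₂ _+_ descents≡ length≡ ⟩
      suc (suc k + k)               ≡⟨ cong suc (semilength k) ⟩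
      suc (2 * k + 1)               ∎)
    ballot : prefixOK 0 P ≡ true
    ballot = trans (sym (properPrefixOK-++-D 0 P)) (trans (cong (properPrefixOK 0) P++D≡) ok)
    balanced : Balanced P
    balanced = trans countU≡ (sym countD≡)
    countUD≡ : countUD P ≡ k
    countUD≡ = begin
      countUD P             ≡⟨ sym (countUD-++-D {P} ballot balanced) ⟩
      countUD (P ++ D ∷ []) ≡⟨ cong countUD P++D≡ ⟩
      countUD (toWord bs)   ≡⟨ countUD-toWord bs ⟩
      length bs             ≡⟨ length≡ ⟩
      k                     ∎
    countUUD≡ : countUUD P ≡ m
    countUUD≡ = begin
      countUUD P             ≡⟨ sym (countUUD-++-D {P} ballot balanced) ⟩
      countUUD (P ++ D ∷ []) ≡⟨ cong countUUD P++D≡ ⟩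
      countUUD (toWord bs)   ≡⟨ countUUD-toWord bs ⟩
      positives (ascents bs) ≡⟨ positives≡ ⟩
      m                      ∎

blockWordLength : ℕ → ℕ
blockWordLength k = (2 * k + 1) + suc (2 * k + 1)

length-toWord : ∀ {k m} bs → BlockStats k m bs → length (toWord bs) ≡ blockWordLength k
length-toWord {k} bs (length≡ , ascents≡ , descents≡ , _) = begin
  length (toWord bs)                      ≡⟨ length≡countU+countD (toWord bs) ⟩
  countU (toWord bs) + countD (toWord bs) ≡⟨ cong₂ _+_ (countU-toWord bs) (countD-toWord bs) ⟩
  (sum (ascents bs) + length bs) + (sum (descents bs) + length bs)
    ≡⟨ cong₂ _+_ (cong₂ _+_ ascents≡ length≡) (cong₂ _+_ descents≡ length≡) ⟩
  (suc k + k) + suc (suc k + k) ≡⟨ cong₂ (λ a b → a + suc b) (semilength k) (semilength k) ⟩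
  (2 * k + 1) + suc (2 * k + 1) ∎
  where open ≡-Reasoning

BlockWord-length : ∀ {k m y} → BlockWord k m y → length y ≡ blockWordLength k
BlockWord-length {y = y} (toWord≡ , stats) = trans (cong length (sym toWord≡)) (length-toWord (blocks y) stats)

-- Rotating the blocks of a Dyck path

search : (ℕ → Bool) → ℕ → ℕ
search p zero = zero
search p (suc n) = if p zero then zero else suc (search (p ∘ suc) n)

search-correct : ∀ p n {j} → j < n → p j ≡ true → search p n < n × p (search p n) ≡ true
search-correct p (suc n) {j} j< pj with p zero in p0
... | true = s≤s z≤n , p0
search-correct p (suc n) {zero} j< pj | false = contradiction (trans (sym p0) pj) λ ()
search-correct p (suc n) {suc j} (s≤s j<) pj | false = Product.map₁ s≤s (search-correct (p ∘ suc) n j< pj)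

mirror : ℕ → ℕ → ℕ
mirror k r = k ∸ suc r

suc-mirror : ∀ {k r} → r < k → suc (mirror k r) ≡ k ∸ r
suc-mirror r< = sym (+-∸-assoc 1 r<)

mirror-< : ∀ {k r} → r < k → mirror k r < k
mirror-< {k} {r} r< = subst (_≤ k) (sym (suc-mirror r<)) (m∸n≤m k r)

mirror-involutive : ∀ {k r} → r < k → mirror k (mirror k r) ≡ r
mirror-involutive {k} {r} r< = trans (cong (k ∸_) (suc-mirror r<)) (m∸[m∸n]≡n (<⇒≤ r<))

isBallotRotation : List Block → ℕ → Bool
isBallotRotation bs i = properPrefixOK 0 (toWord (rotate i bs))

ballotRotation : ℕ → List Block → ℕ
ballotRotation k bs = search (isBallotRotation bs) k

module _ {k m : ℕ} (bs : List Block) (stats : BlockStats k m bs) where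

  isBallotRotation⇔Good : ∀ i → isBallotRotation bs i ≡ true ⇔ Good (rotate i (diffs bs))
  isBallotRotation⇔Good i = subst (λ v → isBallotRotation bs i ≡ true ⇔ Good v) (diffs-rotate i bs)
    (properPrefixOK⇔Good (rotate i bs) (BlockStats⇒sumℤ-diffs (rotate i bs) (BlockStats-rotate i bs stats)))

  private
    length-diffs : length (diffs bs) ≡ k
    length-diffs = trans (length-map diff bs) (proj₁ stats)

  ballotRotation-correct : ballotRotation k bs < k × isBallotRotation bs (ballotRotation k bs) ≡ true
  ballotRotation-correct with good-rotation-exists (diffs bs) (BlockStats⇒sumℤ-diffs bs stats)
  ... | j , j< , good = search-correct (isBallotRotation bs) k (subst (j <_) length-diffs j<)
                          (Equivalence.from (isBallotRotation⇔Good j) good)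

  ballotRotation-unique : ∀ {i} → i < k → isBallotRotation bs i ≡ true → ballotRotation k bs ≡ i
  ballotRotation-unique {i} i< ok = good-rotation-unique {diffs bs} g i (BlockStats⇒sumℤ-diffs bs stats)
    (subst (g <_) (sym length-diffs) (proj₁ ballotRotation-correct)) (subst (i <_) (sym length-diffs) i<)
    (Equivalence.to (isBallotRotation⇔Good g) (proj₂ ballotRotation-correct))
    (Equivalence.to (isBallotRotation⇔Good i) ok)
    where g = ballotRotation k bs

-- Rotating by 1 + r rather than r keeps the inverse rotation mirror k g below k.
rotatedWord : List Step × ℕ → List Step
rotatedWord (P , r) = toWord (rotate (suc r) (blocks (P ++ D ∷ [])))

unrotated : ℕ → List Step → List Step × ℕ
unrotated k y = pathOf (rotate g (blocks y)) , mirror k g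
  where g = ballotRotation k (blocks y)

unrotated-toWord : ∀ k bs →
  unrotated k (toWord bs) ≡ (pathOf (rotate (ballotRotation k bs) bs) , mirror k (ballotRotation k bs))
unrotated-toWord k bs =
  cong (λ cs → pathOf (rotate (ballotRotation k cs) cs) , mirror k (ballotRotation k cs)) (blocks-toWord bs)

module _ {k m : ℕ} {P : List Step} {r : ℕ} (dyck : DyckWith (2 * k + 1) k m P) (r< : r < k) where

  private
    bs₀ = blocks (P ++ D ∷ [])
    bs = rotate (suc r) bs₀
    stats₀ = BlockStats-dyck dyck
    stats = BlockStats-rotate (suc r) bs₀ stats₀

  BlockWord-rotatedWord : BlockWord k m (rotatedWord (P , r))
  BlockWord-rotatedWord = cong toWord (blocks-toWord bs) , subst (BlockStats k m) (sym (blocks-toWord bs)) stats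

  unrotated-rotatedWord : unrotated k (rotatedWord (P , r)) ≡ (P , r)
  unrotated-rotatedWord = begin
    unrotated k (toWord bs)                                 ≡⟨ unrotated-toWord k bs ⟩
    pathOf (rotate g bs) , mirror k g                       ≡⟨ cong (λ i → pathOf (rotate i bs) , mirror k i) g≡ ⟩
    pathOf (rotate (mirror k r) bs) , mirror k (mirror k r) ≡⟨ cong₂ _,_ (cong pathOf back) (mirror-involutive r<) ⟩
    pathOf bs₀ , r                                          ≡⟨ cong (_, r) (pathOf-unique bs₀ P (toWord-blocks-dyck dyck)) ⟩
    P , r                                                   ∎
    where
    open ≡-Reasoning
    g = ballotRotation k bs
    back : rotate (mirror k r) bs ≡ bs₀
    back = trans (cong (λ n → rotate (n ∸ suc r) bs) (sym (proj₁ stats₀))) (rotate-inverse (suc r) bs₀)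
    g≡ : g ≡ mirror k r
    g≡ = ballotRotation-unique bs stats (mirror-< r<) (trans (cong (properPrefixOK 0 ∘ toWord) back) (properPrefixOK-dyck dyck))

module _ {k m : ℕ} {y : List Step} (blockWord : BlockWord k m y) where

  private
    bs = blocks y
    stats = proj₂ blockWord
    g = ballotRotation k bs
    g< = proj₁ (ballotRotation-correct bs stats)
    bs′ = rotate g bs
    stats′ = BlockStats-rotate g bs stats
    nonempty : 0 < length bs′
    nonempty = subst (0 <_) (sym (proj₁ stats′)) (≤-<-trans z≤n g<)

  DyckWith-unrotated : DyckWith (2 * k + 1) k m (proj₁ (unrotated k y))
  DyckWith-unrotated = DyckWith-pathOf bs′ nonempty stats′ (proj₂ (ballotRotation-correct bs stats))

  mirror-unrotated : proj₂ (unrotated k y) < k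
  mirror-unrotated = mirror-< g<

  rotatedWord-unrotated : rotatedWord (unrotated k y) ≡ y
  rotatedWord-unrotated = begin
    toWord (rotate (suc (mirror k g)) (blocks (pathOf bs′ ++ D ∷ [])))
      ≡⟨ cong₂ (λ i cs → toWord (rotate i (blocks cs))) (suc-mirror g<) (pathOf-++-D bs′ nonempty) ⟩
    toWord (rotate (k ∸ g) (blocks (toWord bs′)))
      ≡⟨ cong₂ (λ n cs → toWord (rotate (n ∸ g) cs)) (sym (proj₁ stats)) (blocks-toWord bs′) ⟩
    toWord (rotate (length bs ∸ g) (rotate g bs)) ≡⟨ cong toWord (rotate-inverse g bs) ⟩
    toWord bs                                     ≡⟨ proj₁ blockWord ⟩
    y                                             ∎
    where open ≡-Reasoning

rotations-count : ∀ k m → w (2 * k + 1) k m * k ≡ length (filter (blockWord? k m) (words (blockWordLength k)))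
rotations-count k m = trans (sym (length-filter-×-upTo _ (words (n + n)) k))
  (length-filter-bijection _ (blockWord? k m) rotatedWord (unrotated k)
    (Unique.cartesianProduct⁺ (words-unique (n + n)) (Unique.upTo⁺ k)) (words-unique (blockWordLength k)) to from)
  where
  n = 2 * k + 1
  to : ∀ {z} → z ∈ cartesianProduct (words (n + n)) (upTo k) → T (isDyckWith n k m (proj₁ z)) →
    rotatedWord z ∈ words (blockWordLength k) × BlockWord k m (rotatedWord z) × unrotated k (rotatedWord z) ≡ z
  to {P , r} z∈ t = ∈-words _ (BlockWord-length blockWord) , blockWord , unrotated-rotatedWord dyck r<
    where
    dyck = T⇒DyckWith P t
    r< = ∈-upTo⁻ (proj₂ (∈-cartesianProduct⁻ (words (n + n)) (upTo k) z∈))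
    blockWord = BlockWord-rotatedWord dyck r<
  from : ∀ {y} → y ∈ words (blockWordLength k) → BlockWord k m y →
    unrotated k y ∈ cartesianProduct (words (n + n)) (upTo k) × T (isDyckWith n k m (proj₁ (unrotated k y))) ×
    rotatedWord (unrotated k y) ≡ y
  from {y} _ blockWord =
    ∈-cartesianProduct⁺ (∈-words _ (DyckWith-length dyck)) (∈-upTo⁺ (mirror-unrotated blockWord)) ,
    DyckWith⇒T _ dyck , rotatedWord-unrotated blockWord
    where dyck = DyckWith-unrotated blockWord

-- Exchanging m and k + 1 - m

setAscents : List ℕ → List Block → List Block
setAscents (a ∷ as) ((_ , e) ∷ bs) = (a , e) ∷ setAscents as bs
setAscents _ _ = []

ascents-setAscents : ∀ as bs → length as ≡ length bs → ascents (setAscents as bs) ≡ as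
ascents-setAscents [] [] _ = refl
ascents-setAscents (a ∷ as) (_ ∷ bs) eq = cong (a ∷_) (ascents-setAscents as bs (suc-injective eq))

descents-setAscents : ∀ as bs → length as ≡ length bs → descents (setAscents as bs) ≡ descents bs
descents-setAscents [] [] _ = refl
descents-setAscents (a ∷ as) ((_ , e) ∷ bs) eq = cong (e ∷_) (descents-setAscents as bs (suc-injective eq))

length-setAscents : ∀ as bs → length as ≡ length bs → length (setAscents as bs) ≡ length bs
length-setAscents [] [] _ = refl
length-setAscents (a ∷ as) (_ ∷ bs) eq = cong suc (length-setAscents as bs (suc-injective eq))

setAscents-ascents : ∀ bs → setAscents (ascents bs) bs ≡ bs
setAscents-ascents [] = refl
setAscents-ascents (b ∷ bs) = cong (b ∷_) (setAscents-ascents bs)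

setAscents-setAscents : ∀ as as′ bs → length as′ ≡ length bs → setAscents as (setAscents as′ bs) ≡ setAscents as bs
setAscents-setAscents as [] [] _ = refl
setAscents-setAscents [] (_ ∷ _) (_ ∷ _) _ = refl
setAscents-setAscents (a ∷ as) (_ ∷ as′) ((_ , e) ∷ bs) eq = cong ((a , e) ∷_) (setAscents-setAscents as as′ bs (suc-injective eq))

dualBlocks : List Block → List Block
dualBlocks bs = setAscents (dualComposition (ascents bs)) bs

module _ {k m m′ : ℕ} (m+m′ : m + m′ ≡ suc k) (bs : List Block) (stats : BlockStats k m bs) where

  private
    length≡ = proj₁ stats
    xs = ascents bs
    composition : IsComposition k xs
    composition = trans (length-map proj₁ bs) length≡ , proj₁ (proj₂ stats)
    ys = dualComposition xs
    fits : length ys ≡ length bs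
    fits = trans (proj₁ (dualComposition-IsComposition xs composition)) (sym length≡)
    ascents≡ : ascents (dualBlocks bs) ≡ ys
    ascents≡ = ascents-setAscents ys bs fits

  BlockStats-dualBlocks : BlockStats k m′ (dualBlocks bs)
  BlockStats-dualBlocks =
    trans (length-setAscents ys bs fits) length≡ ,
    trans (cong sum ascents≡) (proj₂ (dualComposition-IsComposition xs composition)) ,
    trans (cong sum (descents-setAscents ys bs fits)) (proj₁ (proj₂ (proj₂ stats))) ,
    +-cancelʳ-≡ m (positives (ascents (dualBlocks bs))) m′ (begin
      positives (ascents (dualBlocks bs)) + m ≡⟨ cong₂ (λ zs n → positives zs + n) ascents≡ (sym (proj₂ (proj₂ (proj₂ stats)))) ⟩
      positives ys + positives xs             ≡⟨ positives-dualComposition xs composition ⟩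
      suc k                                   ≡⟨ sym m+m′ ⟩
      m + m′                                  ≡⟨ +-comm m m′ ⟩
      m′ + m                                  ∎)
    where open ≡-Reasoning

  dualBlocks-involutive : dualBlocks (dualBlocks bs) ≡ bs
  dualBlocks-involutive = begin
    setAscents (dualComposition (ascents (dualBlocks bs))) (setAscents ys bs)
      ≡⟨ cong (λ zs → setAscents (dualComposition zs) (setAscents ys bs)) ascents≡ ⟩
    setAscents (dualComposition ys) (setAscents ys bs)
      ≡⟨ setAscents-setAscents (dualComposition ys) ys bs fits ⟩
    setAscents (dualComposition ys) bs
      ≡⟨ cong (λ zs → setAscents zs bs) (dualComposition-involutive xs composition) ⟩
    setAscents xs bs
      ≡⟨ setAscents-ascents bs ⟩
    bs ∎
    where open ≡-Reasoning

dualWord : List Step → List Step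
dualWord y = toWord (dualBlocks (blocks y))

module _ {k m m′ : ℕ} (m+m′ : m + m′ ≡ suc k) {y : List Step} (blockWord : BlockWord k m y) where

  private
    bs = blocks y

  BlockWord-dualWord : BlockWord k m′ (dualWord y)
  BlockWord-dualWord = cong toWord (blocks-toWord (dualBlocks bs)) ,
    subst (BlockStats k m′) (sym (blocks-toWord (dualBlocks bs))) (BlockStats-dualBlocks m+m′ bs (proj₂ blockWord))

  dualWord-involutive : dualWord (dualWord y) ≡ y
  dualWord-involutive = begin
    toWord (dualBlocks (blocks (toWord (dualBlocks bs)))) ≡⟨ cong (toWord ∘ dualBlocks) (blocks-toWord (dualBlocks bs)) ⟩
    toWord (dualBlocks (dualBlocks bs))                   ≡⟨ cong toWord (dualBlocks-involutive m+m′ bs (proj₂ blockWord)) ⟩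
    toWord bs                                             ≡⟨ proj₁ blockWord ⟩
    y                                                     ∎
    where open ≡-Reasoning

dual-count : ∀ {k m m′} → m + m′ ≡ suc k →
  length (filter (blockWord? k m) (words (blockWordLength k))) ≡ length (filter (blockWord? k m′) (words (blockWordLength k)))
dual-count {k} {m} {m′} m+m′ = length-filter-bijection (blockWord? k m) (blockWord? k m′) dualWord dualWord
  (words-unique (blockWordLength k)) (words-unique (blockWordLength k)) (dualize m+m′) (dualize (trans (+-comm m′ m) m+m′))
  where
  dualize : ∀ {m m′} → m + m′ ≡ suc k → ∀ {y} → y ∈ words (blockWordLength k) → BlockWord k m y →
    dualWord y ∈ words (blockWordLength k) × BlockWord k m′ (dualWord y) × dualWord (dualWord y) ≡ y
  dualize m+m′ _ blockWord = ∈-words _ (BlockWord-length (BlockWord-dualWord m+m′ blockWord)) ,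
    BlockWord-dualWord m+m′ blockWord , dualWord-involutive m+m′ blockWord

theorem1p1 : (k m : ℕ) → 1 ≤ k → 1 ≤ m → m ≤ k →
    w (2 * k + 1) k m ≡ w (2 * k + 1) k (k + 1 ∸ m)
theorem1p1 k m 1≤k _ m≤k = *-cancelʳ-≡ _ _ k {{>-nonZero 1≤k}} (begin
  w n k m * k                                                   ≡⟨ rotations-count k m ⟩
  length (filter (blockWord? k m) (words (blockWordLength k)))  ≡⟨ dual-count m+m′ ⟩
  length (filter (blockWord? k m′) (words (blockWordLength k))) ≡⟨ sym (rotations-count k m′) ⟩
  w n k m′ * k                                                  ∎)
  where
  open ≡-Reasoning
  n = 2 * k + 1
  m′ = k + 1 ∸ m
  m+m′ : m + m′ ≡ suc k
  m+m′ = trans (m+[n∸m]≡n (≤-trans m≤k (m≤m+n k 1))) (+-comm k 1)
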